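{- For every positive integer $p$, the $3\times p$ grid graph satisfies $F_{cd}(G_{3,p}) = p+1$.
   Context: The grid graph $G_{a,b}$ has vertex set $\{(i,j): 1\le i\le a,\ 1\le j\le b\}$, with $(i,j)$ adjacent to $(i,j+1)$ and to $(i+1,j)$ whenever these are vertices. Color-change rule: if each vertex is colored black or white, and a black vertex $u$ has exactly one white neighbor $v$, then $v$ is recolored black. A zero forcing set is a vertex set $Z$ such that, starting with exactly the vertices of $Z$ black, repeated application of the color-change rule colors every vertex black. A connected dom-forcing set is a vertex set $S$ that is dominating (every vertex is in $S$ or adjacent to a vertex of $S$), induces a connected subgraph, and is a zero forcing set; $F_{cd}(\cdot)$ is the minimum size of such a set. -}

module Defs where

open import Data.Nat using (ℕ; zero; suc; _≤_)
open import Data.Fin using (Fin; toℕ)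
open import Data.Bool using (Bool; true; false)
open import Data.List using (List; allFin; cartesianProduct; filterᵇ; length)
open import Data.Product using (_×_; _,_; ∃-syntax)
open import Data.Sum using (_⊎_)
open import Relation.Binary.PropositionalEquality using (_≡_; _≢_)

-- Vertices of the grid graph G_{a,b}: pairs (i , j), 0-indexed via Fin
-- (vertex (i , j) here corresponds to (i+1 , j+1) in the paper).
Vertex : ℕ → ℕ → Set
Vertex a b = Fin a × Fin b

data Adj {a b : ℕ} : Vertex a b → Vertex a b → Set where
  right : ∀ {i j j'} → toℕ j' ≡ suc (toℕ j) → Adj (i , j) (i , j')
  left  : ∀ {i j j'} → toℕ j ≡ suc (toℕ j') → Adj (i , j) (i , j')
  down  : ∀ {i i' j} → toℕ i' ≡ suc (toℕ i) → Adj (i , j) (i' , j)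
  up    : ∀ {i i' j} → toℕ i ≡ suc (toℕ i') → Adj (i , j) (i' , j)

VSet : ℕ → ℕ → Set
VSet a b = Vertex a b → Bool

_∈_ : ∀ {a b} → Vertex a b → VSet a b → Set
v ∈ S = S v ≡ true

allVertices : ∀ a b → List (Vertex a b)
allVertices a b = cartesianProduct (allFin a) (allFin b)

size : ∀ {a b} → VSet a b → ℕ
size {a} {b} S = length (filterᵇ S (allVertices a b))

-- Vertices eventually coloured black when starting from exactly Z black
-- and repeatedly applying the colour-change rule (least set containing Z
-- and closed under: u black, v a neighbour of u, every other neighbour of
-- u black  ⇒  v black).
data Forced {a b : ℕ} (Z : VSet a b) : Vertex a b → Set where
  initial : ∀ {v} → v ∈ Z → Forced Z v
  force   : ∀ {u v} → Forced Z u → Adj u v →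
            (∀ w → Adj u w → w ≢ v → Forced Z w) → Forced Z v

IsZeroForcing : ∀ {a b} → VSet a b → Set
IsZeroForcing Z = ∀ v → Forced Z v

IsDominating : ∀ {a b} → VSet a b → Set
IsDominating S = ∀ v → v ∈ S ⊎ (∃[ u ] (u ∈ S × Adj u v))

data ReachIn {a b : ℕ} (S : VSet a b) : Vertex a b → Vertex a b → Set where
  here : ∀ {u} → u ∈ S → ReachIn S u u
  step : ∀ {u w v} → ReachIn S u w → Adj w v → v ∈ S → ReachIn S u v

IsConnectedIn : ∀ {a b} → VSet a b → Set
IsConnectedIn S = ∀ u v → u ∈ S → v ∈ S → ReachIn S u v

IsConnDomForcing : ∀ {a b} → VSet a b → Set
IsConnDomForcing S = IsDominating S × IsConnectedIn S × IsZeroForcing S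

FcdEq : ℕ → ℕ → ℕ → Set
FcdEq a b k =
  (∃[ S ] (IsConnDomForcing {a} {b} S × size S ≡ k)) ×
  (∀ (S : VSet a b) → IsConnDomForcing S → k ≤ size S)

-- Write f c for the number of vertices of S in column c of G_{3,p}. Then
-- Σ f + #{empty columns} = p + Σ (f c ∸ 1), so |S| ≥ p + 1 as soon as the empty
-- columns are outnumbered by this excess. A walk in S meets every column between its
-- ends, so only the two end columns can be empty, and by domination an empty end
-- column makes its neighbouring column full, which contributes excess 2. If both end
-- columns are occupied, the two outer rows form a fort, so S meets them; dominating
-- the opposite outer vertex of that column, directly or through a walk of S crossing
-- into the column, yields a column holding two vertices of S. If both end columns are
-- empty and their full neighbours coincide, then p = 3 and S misses the four corners,
-- which form a fort.
-- Conversely the middle row together with one corner is connected and dominating, and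
-- forces the first column, after which forcing sweeps the grid column by column.

module Submission where

open import Defs
open import Data.Nat.Properties
open import Algebra.Properties.CommutativeMonoid.Sum +-0-commutativeMonoid
  using (sum; sum-syntax; sum-cong-≗; sum-replicate-zero; sum-remove; ∑-distrib-+; ∑-comm)
open import Data.Bool using (Bool; true; false)
import Data.Bool as Bool
open import Data.Empty using (⊥; ⊥-elim)
open import Data.Fin using (Fin; zero; suc; toℕ; fromℕ; inject₁; opposite; punchIn; punchOut)
open import Data.Fin.Induction using (<-weakInduction)
open import Data.Fin.Properties
  using ( toℕ-injective; toℕ-inject₁; toℕ-fromℕ; toℕ<n; toℕ≤pred[n]; ≤fromℕ; any?
        ; punchInᵢ≢i; punchIn-punchOut; punchIn-injective )
  renaming (_≟_ to _≟ᶠ_; ≤-antisym to ≤ᶠ-antisym)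
open import Data.List using (_++_; map; length; filterᵇ; tabulate; cartesianProduct)
open import Data.List.Properties using (length-++; filter-++; map-tabulate)
open import Data.Nat using (ℕ; zero; suc; _+_; _∸_; _≤_; _<_; z≤n; s≤s; _≤?_)
open import Data.Product using (_×_; _,_; ∃-syntax; proj₁; proj₂; map₂; swap)
open import Data.Sum using (_⊎_; inj₁; inj₂)
open import Function using (_∘_; id; flip)
open import Relation.Nullary using (¬_; Dec; yes; no; contradiction)
open import Relation.Nullary.Decidable using (_×-dec_)
open import Relation.Unary using (Decidable)
open import Relation.Binary.PropositionalEquality

indicator : Bool → ℕ
indicator true  = 1
indicator false = 0

length-filterᵇ-tabulate : ∀ {A : Set} {n} (g : A → Bool) (h : Fin n → A) →
  length (filterᵇ g (tabulate h)) ≡ ∑[ i < n ] indicator (g (h i))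
length-filterᵇ-tabulate {n = zero}  g h = refl
length-filterᵇ-tabulate {n = suc n} g h with g (h zero)
... | true  = cong suc (length-filterᵇ-tabulate g (h ∘ suc))
... | false = length-filterᵇ-tabulate g (h ∘ suc)

length-filterᵇ-++ : ∀ {A : Set} (g : A → Bool) xs ys →
  length (filterᵇ g (xs ++ ys)) ≡ length (filterᵇ g xs) + length (filterᵇ g ys)
length-filterᵇ-++ g xs ys =
  trans (cong length (filter-++ (Bool.T? ∘ g) xs ys)) (length-++ (filterᵇ g xs))

length-filterᵇ-cartesianProduct : ∀ {A B : Set} {m n} (g : A × B → Bool)
  (h : Fin m → A) (k : Fin n → B) →
  length (filterᵇ g (cartesianProduct (tabulate h) (tabulate k)))
    ≡ ∑[ i < m ] ∑[ j < n ] indicator (g (h i , k j))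
length-filterᵇ-cartesianProduct {m = zero}          g h k = refl
length-filterᵇ-cartesianProduct {m = suc m} {n = n} g h k = begin
  length (filterᵇ g (map (h zero ,_) (tabulate k) ++ rest))
    ≡⟨ length-filterᵇ-++ g (map (h zero ,_) (tabulate k)) rest ⟩
  length (filterᵇ g (map (h zero ,_) (tabulate k))) + length (filterᵇ g rest)
    ≡⟨ cong₂ _+_ (trans (cong (length ∘ filterᵇ g) (map-tabulate k (h zero ,_)))
                        (length-filterᵇ-tabulate g (λ j → h zero , k j)))
                 (length-filterᵇ-cartesianProduct g (h ∘ suc) k) ⟩
  ∑[ j < n ] indicator (g (h zero , k j))
    + ∑[ i < m ] ∑[ j < n ] indicator (g (h (suc i) , k j))                     ∎
  where
  open ≡-Reasoning
  rest = cartesianProduct (tabulate (h ∘ suc)) (tabulate k)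

∑-ones : ∀ n → ∑[ i < n ] 1 ≡ n
∑-ones zero    = refl
∑-ones (suc n) = cong suc (∑-ones n)

∑-pointwise-zero : ∀ {n} (g : Fin n → ℕ) → (∀ i → g i ≡ 0) → sum g ≡ 0
∑-pointwise-zero {n} g g≡0 = trans (sum-cong-≗ g≡0) (sum-replicate-zero n)

∑-supported-at : ∀ {n} (g : Fin n → ℕ) k → (∀ i → i ≢ k → g i ≡ 0) → sum g ≡ g k
∑-supported-at {suc n} g k vanish = begin
  sum g                             ≡⟨ sum-remove {i = k} g ⟩
  g k + ∑[ i < n ] g (punchIn k i)  ≡⟨ cong (g k +_) (∑-pointwise-zero _ (vanish _ ∘ punchInᵢ≢i k)) ⟩
  g k + 0                           ≡⟨ +-identityʳ (g k) ⟩
  g k                               ∎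
  where open ≡-Reasoning

∑-supported-at₂ : ∀ {n} (g : Fin n → ℕ) {k k'} → k ≢ k' →
  (∀ i → i ≢ k → i ≢ k' → g i ≡ 0) → sum g ≡ g k + g k'
∑-supported-at₂ {suc n} g {k} {k'} k≢k' vanish = begin
  sum g                                ≡⟨ sum-remove {i = k} g ⟩
  g k + ∑[ i < n ] g (punchIn k i)     ≡⟨ cong (g k +_) (∑-supported-at _ (punchOut k≢k') vanish′) ⟩
  g k + g (punchIn k (punchOut k≢k'))  ≡⟨ cong (λ i → g k + g i) (punchIn-punchOut k≢k') ⟩
  g k + g k'                           ∎
  where
  open ≡-Reasoning
  vanish′ : ∀ i → i ≢ punchOut k≢k' → g (punchIn k i) ≡ 0
  vanish′ i i≢ = vanish _ (punchInᵢ≢i k i)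
    (λ eq → i≢ (punchIn-injective k i _ (trans eq (sym (punchIn-punchOut k≢k')))))

≤-∑ : ∀ {n} (g : Fin n → ℕ) i → g i ≤ sum g
≤-∑ g zero    = m≤m+n (g zero) _
≤-∑ g (suc i) = ≤-trans (≤-∑ (g ∘ suc) i) (m≤n+m _ (g zero))

+-≤-∑ : ∀ {n} (g : Fin n → ℕ) {i j} → i ≢ j → g i + g j ≤ sum g
+-≤-∑ g {zero}  {zero}  i≢j = contradiction refl i≢j
+-≤-∑ g {zero}  {suc j} _   = +-monoʳ-≤ (g zero) (≤-∑ (g ∘ suc) j)
+-≤-∑ g {suc i} {zero}  _   = ≤-trans (≤-reflexive (+-comm (g (suc i)) (g zero)))
                                      (+-monoʳ-≤ (g zero) (≤-∑ (g ∘ suc) i))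
+-≤-∑ g {suc i} {suc j} i≢j =
  ≤-trans (+-≤-∑ (g ∘ suc) (i≢j ∘ cong suc)) (m≤n+m _ (g zero))

deficit excess : ∀ {n} → (Fin n → ℕ) → ℕ
deficit {n} f = ∑[ i < n ] (1 ∸ f i)
excess  {n} f = ∑[ i < n ] (f i ∸ 1)

∑-deficit-excess : ∀ {n} (f : Fin n → ℕ) → sum f + deficit f ≡ n + excess f
∑-deficit-excess {n} f = begin
  sum f + deficit f                          ≡⟨ ∑-distrib-+ f (λ i → 1 ∸ f i) ⟨
  ∑[ i < n ] (f i + (1 ∸ f i))               ≡⟨ sum-cong-≗ (λ i → split (f i)) ⟩
  ∑[ i < n ] (1 + (f i ∸ 1))                 ≡⟨ ∑-distrib-+ (λ _ → 1) (λ i → f i ∸ 1) ⟩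
  ∑[ i < n ] 1 + excess f                    ≡⟨ cong (_+ excess f) (∑-ones n) ⟩
  n + excess f                               ∎
  where
  open ≡-Reasoning
  split : ∀ m → m + (1 ∸ m) ≡ 1 + (m ∸ 1)
  split zero    = refl
  split (suc m) = trans (cong (suc m +_) (0∸n≡0 m)) (+-identityʳ (suc m))

deficit<excess⇒n<∑ : ∀ {n} (f : Fin n → ℕ) → deficit f < excess f → n + 1 ≤ sum f
deficit<excess⇒n<∑ {n} f d<e = +-cancelʳ-≤ (deficit f) (n + 1) (sum f) (begin
  n + 1 + deficit f       ≡⟨ +-assoc n 1 (deficit f) ⟩
  n + suc (deficit f)     ≤⟨ +-monoʳ-≤ n d<e ⟩
  n + excess f            ≡⟨ ∑-deficit-excess f ⟨
  sum f + deficit f       ∎)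
  where open ≤-Reasoning

-- Counting by columns

module _ {a b : ℕ} where

  Occupied : VSet a b → Fin b → Set
  Occupied S c = ∃[ i ] (i , c) ∈ S

  occupied? : ∀ (S : VSet a b) c → Dec (Occupied S c)
  occupied? S c = any? (λ i → S (i , c) Bool.≟ true)

  Full : VSet a b → Fin b → Set
  Full S c = ∀ i → (i , c) ∈ S

  columnCount : VSet a b → Fin b → ℕ
  columnCount S c = ∑[ i < a ] indicator (S (i , c))

  size≡∑columnCount : ∀ (S : VSet a b) → size S ≡ ∑[ c < b ] columnCount S c
  size≡∑columnCount S =
    trans (length-filterᵇ-cartesianProduct S id id) (∑-comm (λ i c → indicator (S (i , c))))

  occupied⇒1≤columnCount : ∀ (S : VSet a b) {c} → Occupied S c → 1 ≤ columnCount S c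
  occupied⇒1≤columnCount S {c} (i , i∈S) =
    subst (_≤ columnCount S c) (cong indicator i∈S) (≤-∑ (λ i → indicator (S (i , c))) i)

  twoMembers⇒2≤columnCount : ∀ (S : VSet a b) {c i i'} → i ≢ i' →
    (i , c) ∈ S → (i' , c) ∈ S → 2 ≤ columnCount S c
  twoMembers⇒2≤columnCount S {c} i≢i' i∈S i'∈S =
    subst₂ (λ x y → indicator x + indicator y ≤ columnCount S c) i∈S i'∈S
      (+-≤-∑ (λ i → indicator (S (i , c))) i≢i')

  full⇒columnCount≡ : ∀ (S : VSet a b) {c} → Full S c → columnCount S c ≡ a
  full⇒columnCount≡ S full = trans (sum-cong-≗ (cong indicator ∘ full)) (∑-ones a)

-- Walks and domination

module _ {a b : ℕ} where

  Adj-sym : ∀ {u v : Vertex a b} → Adj u v → Adj v u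
  Adj-sym (right e) = left e
  Adj-sym (left e)  = right e
  Adj-sym (down e)  = up e
  Adj-sym (up e)    = down e

  Adj⇒column≤suc : ∀ {u v : Vertex a b} → Adj u v → toℕ (proj₂ v) ≤ suc (toℕ (proj₂ u))
  Adj⇒column≤suc (right e) = ≤-reflexive e
  Adj⇒column≤suc (left e)  = ≤-trans (n≤1+n _) (≤-trans (≤-reflexive (sym e)) (n≤1+n _))
  Adj⇒column≤suc (down _)  = n≤1+n _
  Adj⇒column≤suc (up _)    = n≤1+n _

  module _ {S : VSet a b} where

    ReachIn-target : ∀ {u v} → ReachIn S u v → v ∈ S
    ReachIn-target (here v∈S)     = v∈S
    ReachIn-target (step _ _ v∈S) = v∈S

    ReachIn-prepend : ∀ {u w v} → Adj u w → u ∈ S → ReachIn S w v → ReachIn S u v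
    ReachIn-prepend uw u∈S (here w∈S)       = step (here u∈S) uw w∈S
    ReachIn-prepend uw u∈S (step r adj v∈S) = step (ReachIn-prepend uw u∈S r) adj v∈S

    ReachIn-sym : ∀ {u v} → ReachIn S u v → ReachIn S v u
    ReachIn-sym (here u∈S)       = here u∈S
    ReachIn-sym (step r adj v∈S) = ReachIn-prepend (Adj-sym adj) v∈S (ReachIn-sym r)

    ReachIn-trans : ∀ {u w v} → ReachIn S u w → ReachIn S w v → ReachIn S u v
    ReachIn-trans r (here _)          = r
    ReachIn-trans r (step r' adj v∈S) = step (ReachIn-trans r r') adj v∈S

    ReachIn-occupies : ∀ {u v c} → ReachIn S u v →
      toℕ (proj₂ u) ≤ toℕ c → toℕ c ≤ toℕ (proj₂ v) → Occupied S c
    ReachIn-occupies {u} (here u∈S) lo hi =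
      proj₁ u , subst (λ c → (proj₁ u , c) ∈ S) (≤ᶠ-antisym lo hi) u∈S
    ReachIn-occupies {c = c} (step {w = w} {v = v} r adj v∈S) lo hi with toℕ c ≤? toℕ (proj₂ w)
    ... | yes c≤w = ReachIn-occupies r lo c≤w
    ... | no  c≰w = proj₁ v , subst (λ c → (proj₁ v , c) ∈ S) (≤ᶠ-antisym v≤c hi) v∈S
      where v≤c = ≤-trans (Adj⇒column≤suc adj) (≰⇒> c≰w)

    ReachIn-crosses : ∀ {u v c c'} → ReachIn S u v →
      toℕ (proj₂ u) ≤ toℕ c → toℕ c' ≡ suc (toℕ c) → toℕ c' ≤ toℕ (proj₂ v) →
      ∃[ r ] ((r , c) ∈ S × (r , c') ∈ S)
    ReachIn-crosses (here _) lo c'≡ hi = contradiction (≤-trans (subst (_≤ _) c'≡ hi) lo) 1+n≰n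
    ReachIn-crosses {c' = c'} (step {w = w} r adj v∈S) lo c'≡ hi with toℕ c' ≤? toℕ (proj₂ w)
    ... | yes c'≤w = ReachIn-crosses r lo c'≡ c'≤w
    ... | no  c'≰w with adj
    ...   | right {i} e = i , subst (λ c → (i , c) ∈ S) j≡c (ReachIn-target r)
                            , subst (λ c → (i , c) ∈ S) j'≡c' v∈S
      where
      j≡c = ≤ᶠ-antisym (≤-pred (subst (_ <_) c'≡ (≰⇒> c'≰w))) (≤-pred (subst₂ _≤_ c'≡ e hi))
      j'≡c' = toℕ-injective (trans e (trans (cong (suc ∘ toℕ) j≡c) (sym c'≡)))
    ...   | left e = contradiction (≤-trans hi (≤-trans (n≤1+n _) (≤-reflexive (sym e)))) c'≰w
    ...   | down _ = contradiction hi c'≰w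
    ...   | up _   = contradiction hi c'≰w

ColumnsAdjacent : ∀ {b} → Fin b → Fin b → Set
ColumnsAdjacent c c' = toℕ c' ≡ suc (toℕ c) ⊎ toℕ c ≡ suc (toℕ c')

vacant⇒dominatedSideways : ∀ {a b} {S : VSet a b} {c} → IsDominating S → ¬ Occupied S c →
  ∀ i → ∃[ c' ] (ColumnsAdjacent c c' × (i , c') ∈ S)
vacant⇒dominatedSideways {c = c} dom vacant i with dom (i , c)
... | inj₁ i∈S                        = contradiction (i , i∈S) vacant
... | inj₂ ((_ , c') , u∈S , right e) = c' , inj₂ e , u∈S
... | inj₂ ((_ , c') , u∈S , left e)  = c' , inj₁ e , u∈S
... | inj₂ ((i' , _) , u∈S , down _)  = contradiction (i' , u∈S) vacant
... | inj₂ ((i' , _) , u∈S , up _)    = contradiction (i' , u∈S) vacant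

vacant⇒fullNeighbour : ∀ {a b} {S : VSet (suc a) b} {c} → IsDominating S → ¬ Occupied S c →
  (∀ {c' c''} → ColumnsAdjacent c c' → ColumnsAdjacent c c'' → c' ≡ c'') →
  ∃[ c' ] (ColumnsAdjacent c c' × Full S c')
vacant⇒fullNeighbour {S = S} dom vacant unique with vacant⇒dominatedSideways dom vacant zero
... | c' , adj , _ = c' , adj , full
  where
  full : Full S c'
  full i with vacant⇒dominatedSideways dom vacant i
  ... | c'' , adj' , i∈S = subst (λ d → (i , d) ∈ S) (unique adj' adj) i∈S

neighbour-of-zero : ∀ {n} {c : Fin (suc n)} → ColumnsAdjacent zero c → toℕ c ≡ 1
neighbour-of-zero (inj₁ e) = e

neighbour-of-fromℕ : ∀ {n} {c : Fin (suc n)} → ColumnsAdjacent (fromℕ n) c → n ≡ suc (toℕ c)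
neighbour-of-fromℕ {n} {c} (inj₁ e) =
  contradiction (trans e (cong suc (toℕ-fromℕ n))) (<⇒≢ (toℕ<n c))
neighbour-of-fromℕ {n}     (inj₂ e) = trans (sym (toℕ-fromℕ n)) e

neighbours-of-zero-equal : ∀ {n} {c c' : Fin (suc n)} →
  ColumnsAdjacent zero c → ColumnsAdjacent zero c' → c ≡ c'
neighbours-of-zero-equal adj adj' =
  toℕ-injective (trans (neighbour-of-zero adj) (sym (neighbour-of-zero adj')))

neighbours-of-fromℕ-equal : ∀ {n} {c c' : Fin (suc n)} →
  ColumnsAdjacent (fromℕ n) c → ColumnsAdjacent (fromℕ n) c' → c ≡ c'
neighbours-of-fromℕ-equal adj adj' =
  toℕ-injective (suc-injective (trans (sym (neighbour-of-fromℕ adj)) (neighbour-of-fromℕ adj')))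

-- Forts and forcing

module _ {a b : ℕ} where

  IsFort : (Vertex a b → Set) → Set
  IsFort F = ∀ {u v} → Adj u v → F v → ¬ F u → ∃[ w ] (Adj u w × w ≢ v × F w)

  forced-meets-fort : ∀ {Z : VSet a b} {F : Vertex a b → Set} → Decidable F → IsFort F →
    ∀ {v} → Forced Z v → F v → ∃[ w ] (F w × w ∈ Z)
  forced-meets-fort F? fort (initial v∈Z) Fv = _ , Fv , v∈Z
  forced-meets-fort F? fort (force {u} u-forced adj others) Fv with F? u
  ... | yes Fu = forced-meets-fort F? fort u-forced Fu
  ... | no ¬Fu with fort adj Fv ¬Fu
  ...   | w , uw , w≢v , Fw = forced-meets-fort F? fort (others w uw w≢v) Fw

data IsEnd : Fin 3 → Set where
  first : IsEnd zero
  last  : IsEnd (suc (suc zero))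

isEnd? : Decidable IsEnd
isEnd? zero             = yes first
isEnd? (suc zero)       = no λ ()
isEnd? (suc (suc zero)) = yes last

opposite-isEnd : ∀ {e} → IsEnd e → IsEnd (opposite e)
opposite-isEnd first = last
opposite-isEnd last  = first

opposite-end≢ : ∀ {e} → IsEnd e → opposite e ≢ e
opposite-end≢ first ()
opposite-end≢ last  ()

pred-of-end⇒succ-of-opposite : ∀ {e j : Fin 3} → IsEnd e →
  toℕ e ≡ suc (toℕ j) → toℕ j ≡ suc (toℕ (opposite e))
pred-of-end⇒succ-of-opposite {j = suc zero} last refl = refl

succ-of-end⇒pred-of-opposite : ∀ {e j : Fin 3} → IsEnd e →
  toℕ j ≡ suc (toℕ e) → toℕ (opposite e) ≡ suc (toℕ j)
succ-of-end⇒pred-of-opposite {j = suc zero} first refl = refl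
succ-of-end⇒pred-of-opposite {j = suc (suc zero)} last ()

ends-nonadjacent : ∀ {b e} {k : Fin b} → IsEnd e → ¬ Adj (e , k) (opposite e , k)
ends-nonadjacent first (down ())
ends-nonadjacent first (up ())
ends-nonadjacent last  (down ())
ends-nonadjacent last  (up ())

endRows-fort : ∀ {b} → IsFort {3} {b} (IsEnd ∘ proj₁)
endRows-fort (right _) Fv ¬Fu = contradiction Fv ¬Fu
endRows-fort (left _)  Fv ¬Fu = contradiction Fv ¬Fu
endRows-fort (down {i' = i'} {j} e) Fv _ =
  (opposite i' , j) , up (pred-of-end⇒succ-of-opposite Fv e) ,
  opposite-end≢ Fv ∘ cong proj₁ , opposite-isEnd Fv
endRows-fort (up {i' = i'} {j} e) Fv _ =
  (opposite i' , j) , down (succ-of-end⇒pred-of-opposite Fv e) ,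
  opposite-end≢ Fv ∘ cong proj₁ , opposite-isEnd Fv

corners-fort : IsFort {3} {3} (λ v → IsEnd (proj₁ v) × IsEnd (proj₂ v))
corners-fort (right {i} {j' = j'} e) (Ei , Ej') _ =
  (i , opposite j') , left (pred-of-end⇒succ-of-opposite Ej' e) ,
  opposite-end≢ Ej' ∘ cong proj₂ , (Ei , opposite-isEnd Ej')
corners-fort (left {i} {j' = j'} e) (Ei , Ej') _ =
  (i , opposite j') , right (succ-of-end⇒pred-of-opposite Ej' e) ,
  opposite-end≢ Ej' ∘ cong proj₂ , (Ei , opposite-isEnd Ej')
corners-fort (down {i' = i'} {j} e) (Ei' , Ej) _ =
  (opposite i' , j) , up (pred-of-end⇒succ-of-opposite Ei' e) ,
  opposite-end≢ Ei' ∘ cong proj₁ , (opposite-isEnd Ei' , Ej)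
corners-fort (up {i' = i'} {j} e) (Ei' , Ej) _ =
  (opposite i' , j) , down (succ-of-end⇒pred-of-opposite Ei' e) ,
  opposite-end≢ Ei' ∘ cong proj₁ , (opposite-isEnd Ei' , Ej)

3×3-endColumnsVacant⇒¬zeroForcing : ∀ {n} {S : VSet 3 (suc n)} → n ≡ 2 → IsZeroForcing S →
  ¬ Occupied S zero → ¬ Occupied S (fromℕ n) → ⊥
3×3-endColumnsVacant⇒¬zeroForcing refl zf vacant₀ vacant₂
  with forced-meets-fort (λ v → isEnd? (proj₁ v) ×-dec isEnd? (proj₂ v)) corners-fort
         (zf (zero , zero)) (first , first)
... | (i , _) , (_ , first) , w∈S = vacant₀ (i , w∈S)
... | (i , _) , (_ , last)  , w∈S = vacant₂ (i , w∈S)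

module _ {a b : ℕ} {S : VSet a b} where

  crossingRow⇒crowdedColumn : ∀ {i i' k c} → i ≢ i' → (i , k) ∈ S → (i' , c) ∈ S →
    ∃[ r ] ((r , k) ∈ S × (r , c) ∈ S) → ∃[ d ] 2 ≤ columnCount S d
  crossingRow⇒crowdedColumn {i' = i'} {k} {c} i≢i' i∈S i'∈S (r , rk∈S , rc∈S) with r ≟ᶠ i'
  ... | yes refl = k , twoMembers⇒2≤columnCount S i≢i' i∈S rk∈S
  ... | no r≢i'  = c , twoMembers⇒2≤columnCount S r≢i' rc∈S i'∈S

  verticalNeighbour⇒crowdedColumn : ∀ {i i' i'' k} → ¬ Adj (i , k) (i' , k) →
    (i , k) ∈ S → (i'' , k) ∈ S → Adj (i'' , k) (i' , k) → ∃[ d ] 2 ≤ columnCount S d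
  verticalNeighbour⇒crowdedColumn {i} {i'' = i''} {k} nonadj i∈S i''∈S adj with i'' ≟ᶠ i
  ... | yes refl = contradiction adj nonadj
  ... | no i''≢i = k , twoMembers⇒2≤columnCount S i''≢i i''∈S i∈S

  nonadjacentRows⇒crowdedColumn : ∀ {i i' k} → IsDominating S → IsConnectedIn S →
    i ≢ i' → (∀ {c} → ¬ Adj (i , c) (i' , c)) → (i , k) ∈ S → ∃[ d ] 2 ≤ columnCount S d
  nonadjacentRows⇒crowdedColumn {i' = i'} {k} dom conn i≢i' nonadj i∈S with dom (i' , k)
  ... | inj₁ i'∈S             = k , twoMembers⇒2≤columnCount S i≢i' i∈S i'∈S
  ... | inj₂ (_ , u∈S , down e) = verticalNeighbour⇒crowdedColumn nonadj i∈S u∈S (down e)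
  ... | inj₂ (_ , u∈S , up e)   = verticalNeighbour⇒crowdedColumn nonadj i∈S u∈S (up e)
  ... | inj₂ (_ , u∈S , right e) = crossingRow⇒crowdedColumn i≢i' i∈S u∈S
    (map₂ swap (ReachIn-crosses {S = S} (conn _ _ u∈S i∈S) ≤-refl e ≤-refl))
  ... | inj₂ (_ , u∈S , left e)  = crossingRow⇒crowdedColumn i≢i' i∈S u∈S
    (ReachIn-crosses {S = S} (conn _ _ i∈S u∈S) ≤-refl e ≤-refl)

module _ {a b : ℕ} {Z : VSet a (suc b)} where

  force-rightwards : ∀ {i c c'} → toℕ c' ≡ suc (toℕ c) → Forced Z (i , c) →
    (∀ w → Adj (i , c) w → toℕ (proj₂ w) ≤ toℕ c → Forced Z w) → Forced Z (i , c')
  force-rightwards {i} {c} {c'} c'≡ c-forced earlier = force c-forced (right c'≡) others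
    where
    others : ∀ w → Adj (i , c) w → w ≢ (i , c') → Forced Z w
    others _ (right e)    w≢c' =
      contradiction (cong (i ,_) (toℕ-injective (trans e (sym c'≡)))) w≢c'
    others w adj@(left e) _    = earlier w adj (≤-trans (n≤1+n _) (≤-reflexive (sym e)))
    others w adj@(down _) _    = earlier w adj ≤-refl
    others w adj@(up _)   _    = earlier w adj ≤-refl

  firstColumn-forces : (∀ i → Forced Z (i , zero)) → IsZeroForcing Z
  firstColumn-forces first-forced (i , c) = sweep (toℕ c) c ≤-refl i
    where
    sweep : ∀ m c → toℕ c ≤ m → ∀ i → Forced Z (i , c)
    sweep _       zero    _         i = first-forced i
    sweep (suc m) (suc c) (s≤s c≤m) i =
      force-rightwards (cong suc (sym (toℕ-inject₁ c))) (sweep m (inject₁ c) c≤m′ i)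
        (λ w _ w≤c → sweep m (proj₂ w) (≤-trans w≤c c≤m′) (proj₁ w))
      where c≤m′ = subst (_≤ m) (sym (toℕ-inject₁ c)) c≤m

middleRowAndCorner : ∀ {n} → VSet 3 (suc n)
middleRowAndCorner (zero ,           zero)  = true
middleRowAndCorner (zero ,           suc _) = false
middleRowAndCorner (suc zero ,       _)     = true
middleRowAndCorner (suc (suc zero) , _)     = false

module UpperBound (n : ℕ) where

  S⁺ : VSet 3 (suc n)
  S⁺ = middleRowAndCorner

  size-S⁺ : size S⁺ ≡ suc n + 1
  size-S⁺ = trans (size≡∑columnCount S⁺) (trans (cong (2 +_) (∑-ones n)) (+-comm 1 (suc n)))

  dominating : IsDominating S⁺
  dominating (zero , j)           = inj₂ ((suc zero , j) , refl , up refl)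
  dominating (suc zero , j)       = inj₁ refl
  dominating (suc (suc zero) , j) = inj₂ ((suc zero , j) , refl , down refl)

  hub : Vertex 3 (suc n)
  hub = (suc zero , zero)

  reachable-from-hub : ∀ u → u ∈ S⁺ → ReachIn S⁺ hub u
  reachable-from-hub (zero , zero)  _ = step (here refl) (up refl) refl
  reachable-from-hub (suc zero , c) _ =
    <-weakInduction (λ c → ReachIn S⁺ hub (suc zero , c)) (here refl)
      (λ c r → step r (right (cong suc (sym (toℕ-inject₁ c)))) refl) c
  reachable-from-hub (suc (suc zero) , _) ()

  connected : IsConnectedIn S⁺
  connected u v u∈S v∈S =
    ReachIn-trans (ReachIn-sym (reachable-from-hub u u∈S)) (reachable-from-hub v v∈S)

  firstColumn-forced : ∀ i → Forced S⁺ (i , zero)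
  firstColumn-forced zero             = initial refl
  firstColumn-forced (suc zero)       = initial refl
  firstColumn-forced (suc (suc zero)) = force (initial refl) (down refl) others
    where
    others : ∀ w → Adj hub w → w ≢ (suc (suc zero) , zero) → Forced S⁺ w
    others (suc zero , _)       (right _) _   = initial refl
    others (zero , _)           (up _)    _   = initial refl
    others (suc (suc zero) , _) (down _)  w≢v = contradiction refl w≢v

  zeroForcing : IsZeroForcing S⁺
  zeroForcing = firstColumn-forces firstColumn-forced

module LowerBound {n : ℕ} {S : VSet 3 (suc n)}
  (dom : IsDominating S) (conn : IsConnectedIn S) (zf : IsZeroForcing S) where

  f : Fin (suc n) → ℕ
  f = columnCount S

  between⇒no-deficit : ∀ {u v c} → u ∈ S → v ∈ S →
    toℕ (proj₂ u) ≤ toℕ c → toℕ c ≤ toℕ (proj₂ v) → 1 ∸ f c ≡ 0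
  between⇒no-deficit u∈S v∈S lo hi =
    m≤n⇒m∸n≡0 (occupied⇒1≤columnCount S (ReachIn-occupies (conn _ _ u∈S v∈S) lo hi))

  full⇒excess≡2 : ∀ {c} → Full S c → f c ∸ 1 ≡ 2
  full⇒excess≡2 full = cong (_∸ 1) (full⇒columnCount≡ S full)

  firstVacant⇒secondFull : ¬ Occupied S zero → ∃[ c ] (toℕ c ≡ 1 × Full S c)
  firstVacant⇒secondFull vacant with vacant⇒fullNeighbour {S = S} dom vacant neighbours-of-zero-equal
  ... | c , adj , full = c , neighbour-of-zero adj , full

  lastVacant⇒penultimateFull : ¬ Occupied S (fromℕ n) → ∃[ c ] (n ≡ suc (toℕ c) × Full S c)
  lastVacant⇒penultimateFull vacant
    with vacant⇒fullNeighbour {S = S} dom vacant neighbours-of-fromℕ-equal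
  ... | c , adj , full = c , neighbour-of-fromℕ adj , full

  after-first : ∀ {c₁ c : Fin (suc n)} → toℕ c₁ ≡ 1 → c ≢ zero → toℕ c₁ ≤ toℕ c
  after-first c₁≡1 c≢0 = subst (_≤ _) (sym c₁≡1) (n≢0⇒n>0 (c≢0 ∘ toℕ-injective))

  before-last : ∀ {c₂ c : Fin (suc n)} → n ≡ suc (toℕ c₂) → c ≢ fromℕ n → toℕ c ≤ toℕ c₂
  before-last {c = c} n≡ c≢last = ≤-pred (subst (toℕ c <_) n≡
    (≤∧≢⇒< (toℕ≤pred[n] c) (c≢last ∘ toℕ-injective ∘ flip trans (sym (toℕ-fromℕ n)))))

  crowdedColumn : ∃[ d ] 2 ≤ f d
  crowdedColumn with forced-meets-fort (isEnd? ∘ proj₁) endRows-fort (zf (zero , zero)) first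
  ... | _ , end , i∈S =
    nonadjacentRows⇒crowdedColumn {S = S} dom conn (opposite-end≢ end ∘ sym) (ends-nonadjacent end) i∈S

  bothEndsOccupied : Occupied S zero → Occupied S (fromℕ n) → deficit f < excess f
  bothEndsOccupied (_ , u₀) (_ , uₗ) with crowdedColumn
  ... | k , 2≤fk = begin-strict
    deficit f  ≡⟨ ∑-pointwise-zero _ (λ c → between⇒no-deficit u₀ uₗ z≤n (≤fromℕ c)) ⟩
    0          <⟨ ∸-monoˡ-≤ 1 2≤fk ⟩
    f k ∸ 1    ≤⟨ ≤-∑ (λ c → f c ∸ 1) k ⟩
    excess f   ∎
    where open ≤-Reasoning

  firstColumnVacant : ¬ Occupied S zero → Occupied S (fromℕ n) → deficit f < excess f
  firstColumnVacant vacant (_ , uₗ) with firstVacant⇒secondFull vacant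
  ... | c₁ , c₁≡1 , full = begin-strict
    deficit f   ≡⟨ ∑-supported-at _ zero (λ c c≢0 →
                     between⇒no-deficit (full zero) uₗ (after-first c₁≡1 c≢0) (≤fromℕ c)) ⟩
    1 ∸ f zero  ≤⟨ m∸n≤m 1 (f zero) ⟩
    1           <⟨ n<1+n 1 ⟩
    2           ≡⟨ full⇒excess≡2 full ⟨
    f c₁ ∸ 1    ≤⟨ ≤-∑ (λ c → f c ∸ 1) c₁ ⟩
    excess f    ∎
    where open ≤-Reasoning

  lastColumnVacant : Occupied S zero → ¬ Occupied S (fromℕ n) → deficit f < excess f
  lastColumnVacant (_ , u₀) vacant with lastVacant⇒penultimateFull vacant
  ... | c₂ , n≡ , full = begin-strict
    deficit f        ≡⟨ ∑-supported-at _ (fromℕ n) (λ c c≢last →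
                          between⇒no-deficit u₀ (full zero) z≤n (before-last n≡ c≢last)) ⟩
    1 ∸ f (fromℕ n)  ≤⟨ m∸n≤m 1 (f (fromℕ n)) ⟩
    1                <⟨ n<1+n 1 ⟩
    2                ≡⟨ full⇒excess≡2 full ⟨
    f c₂ ∸ 1         ≤⟨ ≤-∑ (λ c → f c ∸ 1) c₂ ⟩
    excess f         ∎
    where open ≤-Reasoning

  bothEndsVacant : ¬ Occupied S zero → ¬ Occupied S (fromℕ n) → deficit f < excess f
  bothEndsVacant vacant₀ vacantₗ
    with firstVacant⇒secondFull vacant₀ | lastVacant⇒penultimateFull vacantₗ
  ... | c₁ , c₁≡1 , full₁ | c₂ , n≡ , full₂ with c₁ ≟ᶠ c₂
  ... | yes refl =
    ⊥-elim (3×3-endColumnsVacant⇒¬zeroForcing (trans n≡ (cong suc c₁≡1)) zf vacant₀ vacantₗ)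
  ... | no c₁≢c₂ = begin-strict
    deficit f                          ≡⟨ ∑-supported-at₂ _ first≢last (λ c c≢0 c≢last →
                                            between⇒no-deficit (full₁ zero) (full₂ zero)
                                              (after-first c₁≡1 c≢0) (before-last n≡ c≢last)) ⟩
    (1 ∸ f zero) + (1 ∸ f (fromℕ n))   ≤⟨ +-mono-≤ (m∸n≤m 1 (f zero)) (m∸n≤m 1 (f (fromℕ n))) ⟩
    2                                  <⟨ +-monoʳ-≤ 2 (s≤s z≤n) ⟩
    2 + 2                              ≡⟨ cong₂ _+_ (full⇒excess≡2 full₁) (full⇒excess≡2 full₂) ⟨
    (f c₁ ∸ 1) + (f c₂ ∸ 1)            ≤⟨ +-≤-∑ (λ c → f c ∸ 1) c₁≢c₂ ⟩
    excess f                           ∎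
    where
    open ≤-Reasoning
    first≢last : zero ≢ fromℕ n
    first≢last eq = 0≢1+n (trans (trans (cong toℕ eq) (toℕ-fromℕ n)) n≡)

  deficit<excess : deficit f < excess f
  deficit<excess with occupied? S zero | occupied? S (fromℕ n)
  ... | yes occupied₀ | yes occupiedₗ = bothEndsOccupied occupied₀ occupiedₗ
  ... | no vacant₀    | yes occupiedₗ = firstColumnVacant vacant₀ occupiedₗ
  ... | yes occupied₀ | no vacantₗ    = lastColumnVacant occupied₀ vacantₗ
  ... | no vacant₀    | no vacantₗ    = bothEndsVacant vacant₀ vacantₗ

  size-lower-bound : suc n + 1 ≤ size S
  size-lower-bound =
    subst (suc n + 1 ≤_) (sym (size≡∑columnCount S)) (deficit<excess⇒n<∑ f deficit<excess)

mainTheorem16 : (p : ℕ) → 1 ≤ p → FcdEq 3 p (p + 1)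
mainTheorem16 (suc n) _ =
  (S⁺ , (dominating , connected , zeroForcing) , size-S⁺) ,
  λ { S (dom , conn , zf) → LowerBound.size-lower-bound dom conn zf }
  where open UpperBound n
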